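{- Let $\ell$ be a Lyndon word with $|\ell|\ge2$, let $u$ be a word or $u=\infty$, and let $\ell=r_js_js_{j-1}\cdots s_1$ be the iterated standard factorization of $\ell$ with respect to $u$. Then $$r_j<\ell<s_1\le s_2\le\dots\le s_{j-1}\le s_j.$$
   Context: Words over a totally ordered alphabet are compared in lexicographic order (a proper prefix is smaller); $\infty$ denotes a symbol larger than every word. A Lyndon word is a primitive nonempty word smaller than all its proper nonempty suffixes. For a Lyndon word $\ell$ with $|\ell|\ge2$ and $u$ a word or $\infty$, the iterated standard factorization (ISF) of $\ell$ with respect to $u$ is the unique factorization $\ell=r_js_js_{j-1}\cdots s_1$ with $j\ge1$ such that: (a) for every $i\in[j]$, $s_i$ is the lexicographically smallest proper nonempty suffix of $r_js_js_{j-1}\cdots s_i$; (b) for every $i\in[j-1]$, $s_i$ has even length and $s_i<u$; (c) $s_j$ has odd length or $u\le s_j$. (It is obtained by repeatedly removing the smallest proper suffix of the remaining word until the removed suffix fails (b).) -}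

module Defs where

open import Level using (Level)
open import Data.Nat using (ℕ; suc; _≥_)
open import Data.Nat.Properties using ()
open import Data.List using (List; []; _∷_; _++_; length; concat; replicate)
open import Data.Product using (Σ; ∃; ∃-syntax; _×_; _,_)
open import Data.Sum using (_⊎_)
open import Data.Empty using (⊥)
open import Relation.Nullary using (¬_)
open import Relation.Binary.PropositionalEquality using (_≡_)
open import Relation.Binary.Bundles using (StrictTotalOrder)
open import Data.Nat using (_%_)

module Words {a ℓ₁ ℓ₂ : Level} (A : StrictTotalOrder a ℓ₁ ℓ₂) where
  -- NOTE: words are compared with propositional equality; the alphabet order
  -- is assumed to be a strict total order w.r.t. its ≈ (intended: ≡).
  open StrictTotalOrder A renaming (Carrier to Letter; _<_ to _<ₐ_)

  Word : Set a
  Word = List Letter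

  data _<ʷ_ : Word → Word → Set (a Level.⊔ ℓ₁ Level.⊔ ℓ₂) where
    []<∷ : ∀ {x xs} → [] <ʷ (x ∷ xs)
    head< : ∀ {x y xs ys} → x <ₐ y → (x ∷ xs) <ʷ (y ∷ ys)
    tail< : ∀ {x xs ys} → xs <ʷ ys → (x ∷ xs) <ʷ (x ∷ ys)

  _≤ʷ_ : Word → Word → Set (a Level.⊔ ℓ₁ Level.⊔ ℓ₂)
  v ≤ʷ w = v <ʷ w ⊎ v ≡ w

  data WordOr∞ : Set a where
    word : Word → WordOr∞
    ∞    : WordOr∞

  _<ᵘ_ : Word → WordOr∞ → Set (a Level.⊔ ℓ₁ Level.⊔ ℓ₂)
  s <ᵘ word u = s <ʷ u
  s <ᵘ ∞      = Level.Lift _ Data.Unit.⊤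
    where import Data.Unit

  _≤ᵘ_ : WordOr∞ → Word → Set (a Level.⊔ ℓ₁ Level.⊔ ℓ₂)
  word u ≤ᵘ s = u ≤ʷ s
  ∞      ≤ᵘ s = Level.Lift _ ⊥

  NonEmpty : Word → Set a
  NonEmpty w = ¬ (w ≡ [])

  Even Odd : ℕ → Set
  Even n = n % 2 ≡ 0
  Odd n = n % 2 ≡ 1

  Primitive : Word → Set a
  Primitive w = NonEmpty w × ¬ (Σ Word λ v → Σ ℕ λ k → k ≥ 2 × w ≡ concat (replicate k v))

  ProperSuffix : Word → Word → Set a
  ProperSuffix s w = NonEmpty s × Σ Word λ x → NonEmpty x × w ≡ x ++ s

  Lyndon : Word → Set (a Level.⊔ ℓ₁ Level.⊔ ℓ₂)
  Lyndon w = Primitive w × (∀ s → ProperSuffix s w → w <ʷ s)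

  SmallestProperSuffix : Word → Word → Set (a Level.⊔ ℓ₁ Level.⊔ ℓ₂)
  SmallestProperSuffix s w = ProperSuffix s w × (∀ t → ProperSuffix t w → s ≤ʷ t)

  -- ISF w u r ss : w = r_j s_j s_{j-1} ... s_1 is the iterated standard
  -- factorization w.r.t. u, where ss = s_1 ∷ s_2 ∷ ... ∷ s_j (so j ≥ 1).
  data ISF : Word → WordOr∞ → Word → List Word → Set (a Level.⊔ ℓ₁ Level.⊔ ℓ₂) where
    last : ∀ {w u r s} →
           w ≡ r ++ s →
           SmallestProperSuffix s w →
           (Odd (length s) ⊎ u ≤ᵘ s) →
           ISF w u r (s ∷ [])
    step : ∀ {w w' u r s ss} →
           w ≡ w' ++ s →
           SmallestProperSuffix s w →
           Even (length s) → s <ᵘ u →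
           ISF w' u r ss →
           ISF w u r (s ∷ ss)

-- Proof idea: r_j is a proper prefix of ℓ and s₁ a proper suffix, which gives
-- r_j < ℓ < s₁. For the chain, let s be the smallest proper suffix of w = w's
-- and s' that of w'. Then s's is a proper suffix of w, so s ≤ s's. Either
-- s < s' already, or s = s't with t < s; a nonempty such t would be a proper
-- suffix of w smaller than s, so t is empty and s = s'.
module Submission where

open import Defs
open import Level using (Level)
open import Data.Nat using (_≥_)
open import Data.List using (List; []; _∷_; _++_; length)
open import Data.List.Properties using (++-assoc; ++-identityʳ; ++-identityˡ-unique; ++-conicalˡ)
open import Data.List.Relation.Unary.Linked using (Linked; [-]; _∷_)
open import Data.Product using (Σ; _×_; _,_; proj₁)
open import Data.Sum using (_⊎_; inj₁; inj₂)
open import Data.Empty using (⊥-elim)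
open import Relation.Nullary using (¬_)
open import Relation.Binary.PropositionalEquality using (_≡_; refl; sym; trans; cong)
open import Relation.Binary.Bundles using (StrictTotalOrder)

module WordProperties {a ℓ₁ ℓ₂ : Level} (A : StrictTotalOrder a ℓ₁ ℓ₂) where
  open Words A
  open StrictTotalOrder A using (irrefl; asym; module Eq)

  <ʷ-irrefl : ∀ {v} → ¬ v <ʷ v
  <ʷ-irrefl (head< x<x) = irrefl Eq.refl x<x
  <ʷ-irrefl (tail< v<v) = <ʷ-irrefl v<v

  <ʷ-asym : ∀ {v w} → v <ʷ w → ¬ w <ʷ v
  <ʷ-asym (head< x<y) (head< y<x) = asym x<y y<x
  <ʷ-asym (head< x<x) (tail< _)   = irrefl Eq.refl x<x
  <ʷ-asym (tail< _)   (head< x<x) = irrefl Eq.refl x<x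
  <ʷ-asym (tail< v<w) (tail< w<v) = <ʷ-asym v<w w<v

  <ʷ⇒≱ʷ : ∀ {v w} → v <ʷ w → ¬ w ≤ʷ v
  <ʷ⇒≱ʷ v<w (inj₁ w<v) = <ʷ-asym v<w w<v
  <ʷ⇒≱ʷ v<v (inj₂ refl) = <ʷ-irrefl v<v

  ++-nonEmptyˡ : ∀ {xs} ys → NonEmpty xs → NonEmpty (xs ++ ys)
  ++-nonEmptyˡ {xs} ys xs≢[] e = xs≢[] (++-conicalˡ xs ys e)

  xs<ʷxs++ys : ∀ xs {ys} → NonEmpty ys → xs <ʷ (xs ++ ys)
  xs<ʷxs++ys []       {[]}    ys≢[] = ⊥-elim (ys≢[] refl)
  xs<ʷxs++ys []       {_ ∷ _} _     = []<∷
  xs<ʷxs++ys (_ ∷ xs) ys≢[]         = tail< (xs<ʷxs++ys xs ys≢[])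

  <ʷ-++⁻ : ∀ v xs ys → v <ʷ (xs ++ ys) →
           v <ʷ xs ⊎ Σ Word λ t → v ≡ xs ++ t × t <ʷ ys
  <ʷ-++⁻ []      []      _  v<ys      = inj₂ ([] , refl , v<ys)
  <ʷ-++⁻ []      (_ ∷ _) _  _         = inj₁ []<∷
  <ʷ-++⁻ (x ∷ v) []      _  v<ys      = inj₂ (x ∷ v , refl , v<ys)
  <ʷ-++⁻ (_ ∷ _) (_ ∷ _) _  (head< p) = inj₁ (head< p)
  <ʷ-++⁻ (x ∷ v) (_ ∷ xs) ys (tail< p) with <ʷ-++⁻ v xs ys p
  ... | inj₁ v<xs           = inj₁ (tail< v<xs)
  ... | inj₂ (t , v≡xst , t<ys) = inj₂ (t , cong (x ∷_) v≡xst , t<ys)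

  ProperPrefix : Word → Word → Set a
  ProperPrefix r w = Σ Word λ t → NonEmpty t × w ≡ r ++ t

  properPrefix⇒<ʷ : ∀ {r w} → ProperPrefix r w → r <ʷ w
  properPrefix⇒<ʷ {r} (_ , t≢[] , refl) = xs<ʷxs++ys r t≢[]

  properSuffix-++ʳ : ∀ {s' w'} s → ProperSuffix s' w' → ProperSuffix (s' ++ s) (w' ++ s)
  properSuffix-++ʳ {s'} s (s'≢[] , x , x≢[] , refl) =
    ++-nonEmptyˡ s s'≢[] , x , x≢[] , ++-assoc x s' s

  smallestProperSuffix-≤ʷ : ∀ {w s s'} → SmallestProperSuffix s w → NonEmpty s' →
                            ProperSuffix (s' ++ s) w → s ≤ʷ s'
  smallestProperSuffix-≤ʷ {w} {s} {s'} ((_ , z , z≢[] , w≡zs) , s-min) s'≢[] s's-suffix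
    with s-min (s' ++ s) s's-suffix
  ... | inj₂ s≡s's = ⊥-elim (s'≢[] (++-identityˡ-unique s' s≡s's))
  ... | inj₁ s<s's with <ʷ-++⁻ s s' s s<s's
  ...   | inj₁ s<s'                   = inj₁ s<s'
  ...   | inj₂ ([] , s≡s'[] , _)       = inj₂ (trans s≡s'[] (++-identityʳ s'))
  ...   | inj₂ (t@(_ ∷ _) , s≡s't , t<s) =
            ⊥-elim (<ʷ⇒≱ʷ t<s (s-min t ((λ ()) , z ++ s' , ++-nonEmptyˡ s' z≢[] , w≡zs't)))
    where
      w≡zs't : w ≡ (z ++ s') ++ t
      w≡zs't = trans w≡zs (trans (cong (z ++_) s≡s't) (sym (++-assoc z s' t)))

  ISF-head : ∀ {w u r s ss} → ISF w u r (s ∷ ss) → SmallestProperSuffix s w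
  ISF-head (last _ s-sps _)     = s-sps
  ISF-head (step _ s-sps _ _ _) = s-sps

  ISF-properPrefix : ∀ {w u r ss} → ISF w u r ss → ProperPrefix r w
  ISF-properPrefix (last w≡rs ((s≢[] , _) , _) _) = _ , s≢[] , w≡rs
  ISF-properPrefix {r = r} (step {s = s} refl _ _ _ isf) with ISF-properPrefix isf
  ... | t , t≢[] , refl = t ++ s , ++-nonEmptyˡ s t≢[] , ++-assoc r t s

  ISF-linked : ∀ {w u r s ss} → ISF w u r (s ∷ ss) → Linked _≤ʷ_ (s ∷ ss)
  ISF-linked (last _ _ _) = [-]
  ISF-linked (step {s = s} {ss = _ ∷ _} refl s-sps _ _ isf) with ISF-head isf
  ... | s'-suffix@(s'≢[] , _) , _ =
    smallestProperSuffix-≤ʷ s-sps s'≢[] (properSuffix-++ʳ s s'-suffix) ∷ ISF-linked isf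

lemma4p19 : ∀ {a ℓ₁ ℓ₂ : Level} (A : StrictTotalOrder a ℓ₁ ℓ₂) →
    let open Words A in
    (ℓ : Word) (u : WordOr∞) (r s₁ : Word) (ss : List Word) →
    Lyndon ℓ → length ℓ ≥ 2 →
    ISF ℓ u r (s₁ ∷ ss) →
    (r <ʷ ℓ) × (ℓ <ʷ s₁) × Linked _≤ʷ_ (s₁ ∷ ss)
lemma4p19 A ℓ u r s₁ ss (_ , ℓ<suffixes) _ isf =
  properPrefix⇒<ʷ (ISF-properPrefix isf) ,
  ℓ<suffixes s₁ (proj₁ (ISF-head isf)) ,
  ISF-linked isf
  where open WordProperties A
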